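{- Let $M$ be a matroid of rank 3 with ground set $[n]$, and suppose the simplification $\mathrm{si}(M)$ has exactly $L$ long lines. Then $\kappa(M)\le 1+n/2+L$.
   Context: A long line is a flat of rank 2 containing at least 3 elements. $\mathrm{si}(M)$ is the simple matroid obtained from $M$ by deleting loops and all but one element from each parallel class. A non-basis of $M$ is a set of size $r(M)$ that is not a basis. A flat $F$ covers $X$ if $|X\cap F|>r_M(F)$. A flat cover is a set of flats covering every non-basis; $\kappa(M)$ is the minimum size of a flat cover. -}

module Defs where

open import Data.Nat using (ℕ; _≤_; _<_; _+_)
open import Data.Fin using (Fin)
open import Data.Fin.Subset using (Subset; _∈_; _∉_; _⊆_; _∪_; _∩_; ⁅_⁆; ∣_∣; ⊤)
open import Data.List using (List)
open import Data.List.Membership.Propositional using () renaming (_∈_ to _∈ₗ_)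
open import Data.List.Relation.Unary.All using (All)
open import Data.Product using (_×_; Σ)
open import Relation.Binary.PropositionalEquality using (_≡_)
open import Relation.Nullary using (¬_)

record Matroid (n : ℕ) : Set where
  field
    r          : Subset n → ℕ
    r-bounded  : ∀ X → r X ≤ ∣ X ∣
    r-mono     : ∀ X Y → X ⊆ Y → r X ≤ r Y
    r-submod   : ∀ X Y → r (X ∪ Y) + r (X ∩ Y) ≤ r X + r Y
  -- (ℕ-valuedness gives r X ≥ 0)
open Matroid public

module _ {n : ℕ} (M : Matroid n) where

  rank : ℕ
  rank = r M ⊤

  Independent : Subset n → Set
  Independent X = r M X ≡ ∣ X ∣

  Basis : Subset n → Set
  Basis X = Independent X × (r M X ≡ rank)

  NonBasis : Subset n → Set
  NonBasis X = (∣ X ∣ ≡ rank) × ¬ Basis X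

  Flat : Subset n → Set
  Flat F = ∀ e → e ∉ F → r M F < r M (F ∪ ⁅ e ⁆)

  Covers : Subset n → Subset n → Set
  Covers F X = r M F < ∣ X ∩ F ∣

  FlatCover : List (Subset n) → Set
  FlatCover C = All Flat C × (∀ X → NonBasis X → Σ (Subset n) λ F → F ∈ₗ C × Covers F X)

  Loop : Fin n → Set
  Loop e = r M ⁅ e ⁆ ≡ 0

  -- S ⊆ [n] is a set of representatives defining si(M) ≅ M|S:
  -- S contains no loops, no two distinct elements of S are parallel,
  -- and every non-loop is parallel to (or equal to) some element of S.
  SimplificationSet : Subset n → Set
  SimplificationSet S =
      (∀ e → e ∈ S → ¬ Loop e)
    × (∀ e f → e ∈ S → f ∈ S → ¬ e ≡ f → r M (⁅ e ⁆ ∪ ⁅ f ⁆) ≡ 2)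
    × (∀ e → ¬ Loop e → Σ (Fin n) λ f → f ∈ S × (r M (⁅ e ⁆ ∪ ⁅ f ⁆) ≡ 1))

  FlatIn : Subset n → Subset n → Set
  FlatIn S F = F ⊆ S × (∀ e → e ∈ S → e ∉ F → r M F < r M (F ∪ ⁅ e ⁆))

  LongLineIn : Subset n → Subset n → Set
  LongLineIn S F = FlatIn S F × (r M F ≡ 2) × (3 ≤ ∣ F ∣)

-- Three kinds of flats suffice. The loops cl(∅) cover every non-basis
-- containing a loop. The closure of a point f of si(M) covers every
-- non-basis containing two parallel elements; it is needed only when the
-- parallel class of f has at least two elements, and these classes are
-- disjoint, so at most n/2 of them are needed. Finally, three pairwise
-- non-parallel non-loops spanning rank 2 determine a long line of si(M),
-- whose closure covers them.
module Submission where

open import Defs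
open import Data.Nat using (ℕ; suc; _+_; _*_; _≤_; _<_; _≤?_; z≤n; s≤s)
open import Data.Nat.Properties hiding (_≟_)
open import Data.Fin using (Fin; zero; suc; _≟_)
open import Data.Fin.Subset
open import Data.Fin.Subset.Properties
open import Data.Fin.Subset.Induction using (Acc; acc; ⊂-wellFounded)
open import Data.Vec using (_∷_; []; tabulate; here; there)
open import Data.Vec.Properties using (lookup∘tabulate; []=⇒lookup; lookup⇒[]=)
open import Data.List using (List; length; filter; allFin; map; _++_)
  renaming ([] to []ₗ; _∷_ to _∷ₗ_)
open import Data.List.Properties using (length-map; length-++)
open import Data.List.Relation.Unary.All as All using (All)
  renaming ([] to []ᴬ; _∷_ to _∷ᴬ_)
open import Data.List.Relation.Unary.All.Properties using (all-filter; ++⁺)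
  renaming (map⁺ to All-map⁺)
open import Data.List.Relation.Unary.AllPairs using (AllPairs)
  renaming ([] to []ᴾ; _∷_ to _∷ᴾ_)
open import Data.List.Relation.Unary.AllPairs.Properties using ()
  renaming (map⁺ to AllPairs-map⁺)
open import Data.List.Relation.Unary.Any using () renaming (here to hereₗ; there to thereₗ)
open import Data.List.Relation.Unary.Unique.Propositional using (Unique)
open import Data.List.Relation.Unary.Unique.Propositional.Properties using (allFin⁺)
  renaming (filter⁺ to Unique-filter⁺)
open import Data.List.Membership.Propositional using () renaming (_∈_ to _∈ₗ_)
open import Data.List.Membership.Propositional.Properties
  using (∈-filter⁺; ∈-allFin; ∈-map⁺; ∈-++⁺ˡ; ∈-++⁺ʳ)
open import Data.Product using (_×_; Σ; Σ-syntax; ∃-syntax; _,_; proj₁; proj₂)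
open import Data.Sum using (inj₁; inj₂)
open import Function using (_∘_)
open import Function.Bundles using (_⇔_; Equivalence)
open import Relation.Nullary using (¬_; yes; no; does; contradiction)
open import Relation.Nullary.Decidable using (dec-true; _×-dec_)
open import Relation.Unary using (Pred; Decidable)
open import Level using (0ℓ)
open import Relation.Binary.PropositionalEquality
  using (_≡_; _≢_; refl; sym; trans; cong; cong₂; subst; ≢-sym; module ≡-Reasoning)

private
  variable
    n k : ℕ
    x : Fin n
    p q : Subset n

Disjoint : Subset n → Subset n → Set
Disjoint p q = ∀ {x} → x ∈ p → x ∉ q

∪-least : ∀ {r : Subset n} → p ⊆ r → q ⊆ r → p ∪ q ⊆ r
∪-least {p = p} {q} p⊆r q⊆r x∈p∪q with x∈p∪q⁻ p q x∈p∪q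
... | inj₁ x∈p = p⊆r x∈p
... | inj₂ x∈q = q⊆r x∈q

x∈p⇒⁅x⁆⊆p : x ∈ p → ⁅ x ⁆ ⊆ p
x∈p⇒⁅x⁆⊆p {x = x} x∈p y∈⁅x⁆ = subst (_∈ _) (sym (x∈⁅y⁆⇒x≡y _ y∈⁅x⁆)) x∈p

fromDec : {P : Pred (Fin n) 0ℓ} → Decidable P → Subset n
fromDec P? = tabulate (does ∘ P?)

module _ {P : Pred (Fin n) 0ℓ} (P? : Decidable P) where

  ∈-fromDec⁺ : P x → x ∈ fromDec P?
  ∈-fromDec⁺ {x} Px = lookup⇒[]= x _ (trans (lookup∘tabulate _ x) (dec-true (P? x) Px))

  ∈-fromDec⁻ : x ∈ fromDec P? → P x
  ∈-fromDec⁻ {x} x∈ with P? x | trans (sym (lookup∘tabulate (does ∘ P?) x)) ([]=⇒lookup x∈)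
  ... | yes Px | _  = Px
  ... | no _   | ()

x∉p-x : ∀ (p : Subset n) x → x ∉ p - x
x∉p-x (_ ∷ p) zero    ()
x∉p-x (_ ∷ p) (suc x) (there x∈p-x) = x∉p-x p x x∈p-x

suc∣p-x∣≡∣p∣ : ∀ (p : Subset n) {x} → x ∈ p → suc ∣ p - x ∣ ≡ ∣ p ∣
suc∣p-x∣≡∣p∣ (inside  ∷ p) here          = cong (suc ∘ ∣_∣) (p─⊥≡p p)
suc∣p-x∣≡∣p∣ (inside  ∷ p) (there x∈p) = cong suc (suc∣p-x∣≡∣p∣ p x∈p)
suc∣p-x∣≡∣p∣ (outside ∷ p) (there x∈p) = suc∣p-x∣≡∣p∣ p x∈p

∣p∣≡suc⇒∃ : ∣ p ∣ ≡ suc k → ∃[ x ] x ∈ p × ∣ p - x ∣ ≡ k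
∣p∣≡suc⇒∃ {n} {p} ∣p∣≡1+k with nonempty? p
... | yes (x , x∈p) = x , x∈p , suc-injective (trans (suc∣p-x∣≡∣p∣ p x∈p) ∣p∣≡1+k)
... | no p-empty    = contradiction (trans (sym ∣p∣≡1+k)
  (trans (cong ∣_∣ (Empty-unique p-empty)) (∣⊥∣≡0 n))) λ ()

∣p∣≡3⇒distinct : ∣ p ∣ ≡ 3 →
  ∃[ x ] ∃[ y ] ∃[ z ] x ∈ p × y ∈ p × z ∈ p × x ≢ y × x ≢ z × y ≢ z
∣p∣≡3⇒distinct {p = p} ∣p∣≡3 with ∣p∣≡suc⇒∃ ∣p∣≡3
... | x , x∈p , ∣p-x∣≡2 with ∣p∣≡suc⇒∃ ∣p-x∣≡2
... | y , y∈p-x , ∣p-x-y∣≡1 with ∣p∣≡suc⇒∃ ∣p-x-y∣≡1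
... | z , z∈p-x-y , _ =
  x , y , z , x∈p , p─q⊆p p _ y∈p-x , p─q⊆p p _ z∈p-x ,
  (λ { refl → x∉p-x p x y∈p-x }) , (λ { refl → x∉p-x p x z∈p-x }) ,
  (λ { refl → x∉p-x (p - x) y z∈p-x-y })
  where
  z∈p-x = p─q⊆p (p - x) _ z∈p-x-y

length≤∣p∣ : ∀ {xs} → Unique xs → All (_∈ p) xs → length xs ≤ ∣ p ∣
length≤∣p∣ []ᴾ []ᴬ = z≤n
length≤∣p∣ (x∉xs ∷ᴾ xs!) (x∈p ∷ᴬ xs⊆p) =
  ≤-trans (s≤s (length≤∣p∣ xs! xs⊆p-x)) (x∈p⇒∣p-x∣<∣p∣ x∈p)
  where
  xs⊆p-x = All.zipWith (λ (x≢y , y∈p) → x∈p∧x≢y⇒x∈p-y y∈p (≢-sym x≢y)) (x∉xs , xs⊆p)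

∣p∣+∣q∣≤∣p∪q∣ : ∀ (p q : Subset n) → Disjoint p q → ∣ p ∣ + ∣ q ∣ ≤ ∣ p ∪ q ∣
∣p∣+∣q∣≤∣p∪q∣ [] [] _ = z≤n
∣p∣+∣q∣≤∣p∪q∣ (inside ∷ p) (inside ∷ q) disj = contradiction here (disj here)
∣p∣+∣q∣≤∣p∪q∣ (inside ∷ p) (outside ∷ q) disj =
  s≤s (∣p∣+∣q∣≤∣p∪q∣ p q (λ x∈p x∈q → disj (there x∈p) (there x∈q)))
∣p∣+∣q∣≤∣p∪q∣ (outside ∷ p) (inside ∷ q) disj = subst (_≤ suc ∣ p ∪ q ∣) (sym (+-suc ∣ p ∣ ∣ q ∣))
  (s≤s (∣p∣+∣q∣≤∣p∪q∣ p q (λ x∈p x∈q → disj (there x∈p) (there x∈q))))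
∣p∣+∣q∣≤∣p∪q∣ (outside ∷ p) (outside ∷ q) disj =
  ∣p∣+∣q∣≤∣p∪q∣ p q (λ x∈p x∈q → disj (there x∈p) (there x∈q))

Disjoint-⋃ : ∀ {qs} → All (Disjoint p) qs → Disjoint p (⋃ qs)
Disjoint-⋃ []ᴬ x∈p x∈⋃ = ∉⊥ x∈⋃
Disjoint-⋃ {qs = q ∷ₗ qs} (p#q ∷ᴬ p#qs) x∈p x∈⋃ with x∈p∪q⁻ q (⋃ qs) x∈⋃
... | inj₁ x∈q  = p#q x∈p x∈q
... | inj₂ x∈qs = Disjoint-⋃ p#qs x∈p x∈qs

length*k≤∣⋃∣ : ∀ {ps : List (Subset n)} → AllPairs Disjoint ps →
  All (λ p → k ≤ ∣ p ∣) ps → length ps * k ≤ ∣ ⋃ ps ∣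
length*k≤∣⋃∣ []ᴾ []ᴬ = z≤n
length*k≤∣⋃∣ {ps = p ∷ₗ ps} (p#ps ∷ᴾ ps#) (k≤∣p∣ ∷ᴬ k≤∣ps∣) =
  ≤-trans (+-mono-≤ k≤∣p∣ (length*k≤∣⋃∣ ps# k≤∣ps∣))
          (∣p∣+∣q∣≤∣p∪q∣ p (⋃ ps) (Disjoint-⋃ p#ps))

AllPairs-restrict : ∀ {A : Set} {P : A → Set} {R Q : A → A → Set} →
  (∀ {a b} → P a → P b → R a b → Q a b) →
  ∀ {as} → All P as → AllPairs R as → AllPairs Q as
AllPairs-restrict f []ᴬ []ᴾ = []ᴾ
AllPairs-restrict f (Pa ∷ᴬ Pas) (Ra ∷ᴾ Ras) =
  All.zipWith (λ (Pb , Rab) → f Pa Pb Rab) (Pas , Ra) ∷ᴾ AllPairs-restrict f Pas Ras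

module Closure {n : ℕ} (M : Matroid n) where

  private
    variable
      X Y Z A B C : Subset n
      e f : Fin n

  ρ : Subset n → ℕ
  ρ = r M

  ρ-mono : X ⊆ Y → ρ X ≤ ρ Y
  ρ-mono = r-mono M _ _

  ρ-⊥ : ρ ⊥ ≡ 0
  ρ-⊥ = n≤0⇒n≡0 (subst (ρ ⊥ ≤_) (∣⊥∣≡0 n) (r-bounded M ⊥))

  ρ-⁅⁆≤1 : ∀ e → ρ ⁅ e ⁆ ≤ 1
  ρ-⁅⁆≤1 e = subst (ρ ⁅ e ⁆ ≤_) (∣⁅x⁆∣≡1 e) (r-bounded M ⁅ e ⁆)

  -- Submodularity, with ρ C ≤ ρ (A ∩ B).
  ρ-∪-absorb : C ⊆ A → C ⊆ B → ρ B ≤ ρ C → ρ (A ∪ B) ≤ ρ A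
  ρ-∪-absorb {C} {A} {B} C⊆A C⊆B ρB≤ρC = +-cancelʳ-≤ (ρ (A ∩ B)) (ρ (A ∪ B)) (ρ A) (begin
    ρ (A ∪ B) + ρ (A ∩ B) ≤⟨ r-submod M A B ⟩
    ρ A + ρ B             ≤⟨ +-monoʳ-≤ (ρ A) (≤-trans ρB≤ρC (ρ-mono (λ x∈C → x∈p∩q⁺ (C⊆A x∈C , C⊆B x∈C)))) ⟩
    ρ A + ρ (A ∩ B)       ∎)
    where open ≤-Reasoning

  cl : Subset n → Subset n
  cl Y = fromDec (λ e → ρ (Y ∪ ⁅ e ⁆) ≤? ρ Y)

  ∈-cl⁺ : ρ (Y ∪ ⁅ e ⁆) ≤ ρ Y → e ∈ cl Y
  ∈-cl⁺ {Y} = ∈-fromDec⁺ (λ e → ρ (Y ∪ ⁅ e ⁆) ≤? ρ Y)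

  ∈-cl⁻ : e ∈ cl Y → ρ (Y ∪ ⁅ e ⁆) ≤ ρ Y
  ∈-cl⁻ {Y = Y} = ∈-fromDec⁻ (λ e → ρ (Y ∪ ⁅ e ⁆) ≤? ρ Y)

  ∉cl⇒ρ< : e ∉ cl Y → ρ Y < ρ (Y ∪ ⁅ e ⁆)
  ∉cl⇒ρ< e∉clY = ≰⇒> (e∉clY ∘ ∈-cl⁺)

  ⊆-cl : Y ⊆ cl Y
  ⊆-cl e∈Y = ∈-cl⁺ (ρ-mono (∪-least ⊆-refl (x∈p⇒⁅x⁆⊆p e∈Y)))

  ρ-∪-⊆cl : ∀ Y Z → Z ⊆ cl Y → ρ (Y ∪ Z) ≤ ρ Y
  ρ-∪-⊆cl Y Z = go Z (⊂-wellFounded Z)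
    where
    go : ∀ Z → Acc _⊂_ Z → Z ⊆ cl Y → ρ (Y ∪ Z) ≤ ρ Y
    go Z (acc smaller) Z⊆clY with nonempty? Z
    ... | no Z-empty = ρ-mono (∪-least ⊆-refl (λ z∈Z → contradiction (_ , z∈Z) Z-empty))
    ... | yes (x , x∈Z) = begin
      ρ (Y ∪ Z)                        ≤⟨ ρ-mono (∪-least (p⊆p∪q _ ∘ p⊆p∪q _) split) ⟩
      ρ ((Y ∪ (Z - x)) ∪ (Y ∪ ⁅ x ⁆)) ≤⟨ ρ-∪-absorb (p⊆p∪q _) (p⊆p∪q _) (∈-cl⁻ (Z⊆clY x∈Z)) ⟩
      ρ (Y ∪ (Z - x))                  ≤⟨ go (Z - x) (smaller (x∈p⇒p-x⊂p x∈Z)) (Z⊆clY ∘ p─q⊆p Z _) ⟩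
      ρ Y                              ∎
      where
      open ≤-Reasoning
      split : Z ⊆ (Y ∪ (Z - x)) ∪ (Y ∪ ⁅ x ⁆)
      split {z} z∈Z with z ≟ x
      ... | yes refl = q⊆p∪q _ _ (q⊆p∪q Y _ (x∈⁅x⁆ x))
      ... | no z≢x   = p⊆p∪q _ (q⊆p∪q Y _ (x∈p∧x≢y⇒x∈p-y z∈Z z≢x))

  ρ-cl : ρ (cl Y) ≤ ρ Y
  ρ-cl {Y} = ≤-trans (ρ-mono (q⊆p∪q Y _)) (ρ-∪-⊆cl Y (cl Y) ⊆-refl)

  ρ-⊆cl : Z ⊆ cl Y → ρ Z ≤ ρ Y
  ρ-⊆cl Z⊆clY = ≤-trans (ρ-mono Z⊆clY) ρ-cl

  ⊆cl⇒cl⊆cl : Z ⊆ cl Y → cl Z ⊆ cl Y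
  ⊆cl⇒cl⊆cl {Z} {Y} Z⊆clY {e} e∈clZ = ∈-cl⁺ (begin
    ρ (Y ∪ ⁅ e ⁆)             ≤⟨ ρ-mono (∪-least (p⊆p∪q _ ∘ ⊆-cl) (q⊆p∪q _ _ ∘ q⊆p∪q Z _)) ⟩
    ρ (cl Y ∪ (Z ∪ ⁅ e ⁆))    ≤⟨ ρ-∪-absorb Z⊆clY (p⊆p∪q _) (∈-cl⁻ e∈clZ) ⟩
    ρ (cl Y)                  ≤⟨ ρ-cl ⟩
    ρ Y                       ∎)
    where open ≤-Reasoning

  cl⁅⁆⊆cl : e ∈ cl Y → cl ⁅ e ⁆ ⊆ cl Y
  cl⁅⁆⊆cl = ⊆cl⇒cl⊆cl ∘ x∈p⇒⁅x⁆⊆p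

  cl-flat : ∀ Y → Flat M (cl Y)
  cl-flat Y e e∉clY = ∉cl⇒ρ< (e∉clY ∘ ⊆cl⇒cl⊆cl ⊆-refl)

  cl∩-flatIn : ∀ Y S → FlatIn M S (cl Y ∩ S)
  cl∩-flatIn Y S = p∩q⊆q _ _ , λ e e∈S e∉F →
    ∉cl⇒ρ< (λ e∈clF → e∉F (x∈p∩q⁺ (⊆cl⇒cl⊆cl (p∩q⊆p _ _) e∈clF , e∈S)))

  loop⇒∈cl⊥ : Loop M e → e ∈ cl ⊥
  loop⇒∈cl⊥ {e} loop = ∈-cl⁺ (≤-reflexive (begin
    ρ (⊥ ∪ ⁅ e ⁆) ≡⟨ cong ρ (∪-identityˡ ⁅ e ⁆) ⟩
    ρ ⁅ e ⁆       ≡⟨ loop ⟩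
    0             ≡⟨ sym ρ-⊥ ⟩
    ρ ⊥           ∎))
    where open ≡-Reasoning

  ∉cl⊥⇒¬Loop : e ∉ cl ⊥ → ¬ Loop M e
  ∉cl⊥⇒¬Loop e∉cl⊥ = e∉cl⊥ ∘ loop⇒∈cl⊥

  ρ-cl⊥ : ρ (cl ⊥) ≤ 0
  ρ-cl⊥ = ≤-trans ρ-cl (≤-reflexive ρ-⊥)

  pair≤1⇒∈cl : ¬ Loop M e → ρ (⁅ e ⁆ ∪ ⁅ f ⁆) ≤ 1 → f ∈ cl ⁅ e ⁆
  pair≤1⇒∈cl e-nonloop ρef≤1 = ∈-cl⁺ (≤-trans ρef≤1 (n≢0⇒n>0 e-nonloop))

  ∈cl⁅⁆-sym : ¬ Loop M e → e ∈ cl ⁅ f ⁆ → f ∈ cl ⁅ e ⁆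
  ∈cl⁅⁆-sym {e} {f} e-nonloop e∈clf = pair≤1⇒∈cl e-nonloop (begin
    ρ (⁅ e ⁆ ∪ ⁅ f ⁆) ≡⟨ cong ρ (∪-comm ⁅ e ⁆ ⁅ f ⁆) ⟩
    ρ (⁅ f ⁆ ∪ ⁅ e ⁆) ≤⟨ ∈-cl⁻ e∈clf ⟩
    ρ ⁅ f ⁆           ≤⟨ ρ-⁅⁆≤1 f ⟩
    1                 ∎)
    where open ≤-Reasoning

  parallelClass : Fin n → Subset n
  parallelClass f = cl ⁅ f ⁆ ∩ ∁ (cl ⊥)

  nonBasis⇒ρ<rank : NonBasis M X → ρ X < rank M
  nonBasis⇒ρ<rank {X} (∣X∣≡rank , ¬basis) =
    ≤∧≢⇒< (≤-trans (r-bounded M X) (≤-reflexive ∣X∣≡rank))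
          (λ ρX≡rank → ¬basis (trans ρX≡rank (sym ∣X∣≡rank) , ρX≡rank))

module Simplification {n : ℕ} (M : Matroid n) {S : Subset n} (simp : SimplificationSet M S) where

  open Closure M

  private
    variable
      X : Subset n
      e f g : Fin n

    S-nonloop : f ∈ S → ¬ Loop M f
    S-nonloop = proj₁ simp _

    S-pair-rank : f ∈ S → g ∈ S → f ≢ g → ρ (⁅ f ⁆ ∪ ⁅ g ⁆) ≡ 2
    S-pair-rank = proj₁ (proj₂ simp) _ _

  representative : ¬ Loop M e → Σ[ f ∈ Fin n ] f ∈ S × f ∈ cl ⁅ e ⁆ × e ∈ cl ⁅ f ⁆
  representative e-nonloop with proj₂ (proj₂ simp) _ e-nonloop
  ... | f , f∈S , ρef≡1 = f , f∈S , f∈cle , ∈cl⁅⁆-sym (S-nonloop f∈S) f∈cle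
    where f∈cle = pair≤1⇒∈cl e-nonloop (≤-reflexive ρef≡1)

  parallelClass-disjoint : f ∈ S → g ∈ S → f ≢ g → Disjoint (parallelClass f) (parallelClass g)
  parallelClass-disjoint {f} {g} f∈S g∈S f≢g {x} x∈[f] x∈[g] = contradiction 2≤1 λ { (s≤s ()) }
    where
    x-nonloop = ∉cl⊥⇒¬Loop (x∈∁p⇒x∉p (proj₂ (x∈p∩q⁻ _ _ x∈[f])))
    f∈clx = ∈cl⁅⁆-sym x-nonloop (proj₁ (x∈p∩q⁻ _ _ x∈[f]))
    g∈clx = ∈cl⁅⁆-sym x-nonloop (proj₁ (x∈p∩q⁻ _ _ x∈[g]))
    2≤1 : 2 ≤ 1
    2≤1 = subst (_≤ 1) (S-pair-rank f∈S g∈S f≢g)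
      (≤-trans (ρ-⊆cl (∪-least (x∈p⇒⁅x⁆⊆p f∈clx) (x∈p⇒⁅x⁆⊆p g∈clx))) (ρ-⁅⁆≤1 x))

  cl∩S-longLine : ∀ {a b c} → ρ X ≤ 2 → a ≢ b → a ≢ c → b ≢ c →
    a ∈ cl X ∩ S → b ∈ cl X ∩ S → c ∈ cl X ∩ S → LongLineIn M S (cl X ∩ S)
  cl∩S-longLine {X} {a} {b} ρX≤2 a≢b a≢c b≢c a∈F b∈F c∈F =
    cl∩-flatIn X S ,
    ≤-antisym (≤-trans (ρ-⊆cl (p∩q⊆p _ _)) ρX≤2)
              (subst (_≤ ρ (cl X ∩ S)) (S-pair-rank (p∩q⊆q _ _ a∈F) (p∩q⊆q _ _ b∈F) a≢b)
                     (ρ-mono (∪-least (x∈p⇒⁅x⁆⊆p a∈F) (x∈p⇒⁅x⁆⊆p b∈F)))) ,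
    length≤∣p∣ ((a≢b ∷ᴬ a≢c ∷ᴬ []ᴬ) ∷ᴾ (b≢c ∷ᴬ []ᴬ) ∷ᴾ []ᴬ ∷ᴾ []ᴾ) (a∈F ∷ᴬ b∈F ∷ᴬ c∈F ∷ᴬ []ᴬ)

module RankThreeCover {n : ℕ} (M : Matroid n) (rank≡3 : rank M ≡ 3)
  {S : Subset n} (simp : SimplificationSet M S)
  (Ls : List (Subset n)) (Ls-longLines : ∀ F → (F ∈ₗ Ls) ⇔ LongLineIn M S F) where

  open Closure M
  open Simplification M simp

  private
    variable
      X : Subset n
      a b e g h : Fin n

  NontrivialPoint : Fin n → Set
  NontrivialPoint f = f ∈ S × 2 ≤ ∣ parallelClass f ∣

  nontrivialPoint? : Decidable NontrivialPoint
  nontrivialPoint? f = (f ∈? S) ×-dec (2 ≤? ∣ parallelClass f ∣)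

  nontrivialPoints : List (Fin n)
  nontrivialPoints = filter nontrivialPoint? (allFin n)

  cover : List (Subset n)
  cover = cl ⊥ ∷ₗ map (cl ∘ ⁅_⁆) nontrivialPoints ++ map cl Ls

  cover-flat : All (Flat M) cover
  cover-flat = cl-flat ⊥ ∷ᴬ ++⁺ (All-map⁺ (All.universal (cl-flat ∘ ⁅_⁆) nontrivialPoints))
                                (All-map⁺ (All.universal cl-flat Ls))

  nontrivialPoints-bound : length nontrivialPoints * 2 ≤ n
  nontrivialPoints-bound = begin
    length nontrivialPoints * 2                      ≡⟨ cong (_* 2) (sym (length-map parallelClass nontrivialPoints)) ⟩
    length (map parallelClass nontrivialPoints) * 2  ≤⟨ length*k≤∣⋃∣ classes-disjoint classes-large ⟩
    ∣ ⋃ (map parallelClass nontrivialPoints) ∣       ≤⟨ ∣p∣≤n (⋃ (map parallelClass nontrivialPoints)) ⟩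
    n                                                ∎
    where
    open ≤-Reasoning
    nontrivial : All NontrivialPoint nontrivialPoints
    nontrivial = all-filter nontrivialPoint? (allFin n)
    classes-disjoint : AllPairs Disjoint (map parallelClass nontrivialPoints)
    classes-disjoint = AllPairs-map⁺ (AllPairs-restrict
      (λ (f∈S , _) (g∈S , _) → parallelClass-disjoint f∈S g∈S) nontrivial
      (Unique-filter⁺ nontrivialPoint? (allFin⁺ n)))
    classes-large : All (λ p → 2 ≤ ∣ p ∣) (map parallelClass nontrivialPoints)
    classes-large = All-map⁺ (All.map proj₂ nontrivial)

  cover-length : 2 * length cover ≤ 2 + n + 2 * length Ls
  cover-length = begin
    2 * length cover                                          ≡⟨ cong (λ m → 2 * suc m) (trans
                                                                   (length-++ (map (cl ∘ ⁅_⁆) nontrivialPoints))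
                                                                   (cong₂ _+_ (length-map _ nontrivialPoints) (length-map cl Ls))) ⟩
    2 * suc (length nontrivialPoints + length Ls)             ≡⟨ *-suc 2 _ ⟩
    2 + 2 * (length nontrivialPoints + length Ls)             ≡⟨ cong (2 +_) (*-distribˡ-+ 2 (length nontrivialPoints) _) ⟩
    2 + (2 * length nontrivialPoints + 2 * length Ls)         ≡⟨ sym (+-assoc 2 (2 * length nontrivialPoints) _) ⟩
    2 + 2 * length nontrivialPoints + 2 * length Ls           ≤⟨ +-monoˡ-≤ (2 * length Ls) (+-monoʳ-≤ 2
                                                                   (≤-trans (≤-reflexive (*-comm 2 (length nontrivialPoints))) nontrivialPoints-bound)) ⟩
    2 + n + 2 * length Ls                                     ∎
    where open ≤-Reasoning

  Covered : Subset n → Set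
  Covered X = Σ[ F ∈ Subset n ] F ∈ₗ cover × Covers M F X

  cover-loop : e ∈ X → e ∈ cl ⊥ → Covered X
  cover-loop e∈X e∈cl⊥ = cl ⊥ , hereₗ refl ,
    ≤-trans (s≤s ρ-cl⊥) (length≤∣p∣ ([]ᴬ ∷ᴾ []ᴾ) (x∈p∩q⁺ (e∈X , e∈cl⊥) ∷ᴬ []ᴬ))

  cover-parallel : a ∈ X → b ∈ X → a ≢ b → a ∉ cl ⊥ → b ∉ cl ⊥ → b ∈ cl ⁅ a ⁆ → Covered X
  cover-parallel {a} {X} {b} a∈X b∈X a≢b a∉cl⊥ b∉cl⊥ b∈cla with representative (∉cl⊥⇒¬Loop a∉cl⊥)
  ... | f , f∈S , _ , a∈clf = cl ⁅ f ⁆ , thereₗ (∈-++⁺ˡ (∈-map⁺ (cl ∘ ⁅_⁆) f-nontrivial)) ,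
    ≤-trans (s≤s (≤-trans ρ-cl (ρ-⁅⁆≤1 f))) (length≤∣p∣ a,b-distinct (∈X∩clf a∈X a∈clf ∷ᴬ ∈X∩clf b∈X b∈clf ∷ᴬ []ᴬ))
    where
    a,b-distinct : Unique (a ∷ₗ b ∷ₗ []ₗ)
    a,b-distinct = (a≢b ∷ᴬ []ᴬ) ∷ᴾ []ᴬ ∷ᴾ []ᴾ
    b∈clf = cl⁅⁆⊆cl a∈clf b∈cla
    ∈X∩clf : ∀ {x} → x ∈ X → x ∈ cl ⁅ f ⁆ → x ∈ X ∩ cl ⁅ f ⁆
    ∈X∩clf x∈X x∈clf = x∈p∩q⁺ (x∈X , x∈clf)
    ∈[f] : ∀ {x} → x ∈ cl ⁅ f ⁆ → x ∉ cl ⊥ → x ∈ parallelClass f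
    ∈[f] x∈clf x∉cl⊥ = x∈p∩q⁺ (x∈clf , x∉p⇒x∈∁p x∉cl⊥)
    f-nontrivial : f ∈ₗ nontrivialPoints
    f-nontrivial = ∈-filter⁺ nontrivialPoint? (∈-allFin f)
      (f∈S , length≤∣p∣ a,b-distinct (∈[f] a∈clf a∉cl⊥ ∷ᴬ ∈[f] b∈clf b∉cl⊥ ∷ᴬ []ᴬ))

  cover-line : ρ X ≤ 2 → e ∈ X → g ∈ X → h ∈ X → e ≢ g → e ≢ h → g ≢ h →
    ¬ Loop M e → ¬ Loop M g → ¬ Loop M h →
    g ∉ cl ⁅ e ⁆ → h ∉ cl ⁅ e ⁆ → h ∉ cl ⁅ g ⁆ → Covered X
  cover-line {X} ρX≤2 e∈X g∈X h∈X e≢g e≢h g≢h e-nl g-nl h-nl g∉cle h∉cle h∉clg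
    with representative e-nl | representative g-nl | representative h-nl
  ... | e' , e'∈S , e'∈cle , e∈cle' | g' , g'∈S , g'∈clg , g∈clg' | h' , h'∈S , h'∈clh , h∈clh' =
    cl F , thereₗ (∈-++⁺ʳ _ (∈-map⁺ cl F∈Ls)) ,
    ≤-trans (s≤s (ρ-⊆cl (⊆cl⇒cl⊆cl (p∩q⊆p _ _)))) (≤-trans (s≤s ρX≤2)
      (length≤∣p∣ ((e≢g ∷ᴬ e≢h ∷ᴬ []ᴬ) ∷ᴾ (g≢h ∷ᴬ []ᴬ) ∷ᴾ []ᴬ ∷ᴾ []ᴾ)
                  (∈X∩clF e∈X e∈cle' e'∈F ∷ᴬ ∈X∩clF g∈X g∈clg' g'∈F ∷ᴬ ∈X∩clF h∈X h∈clh' h'∈F ∷ᴬ []ᴬ)))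
    where
    F = cl X ∩ S
    rep∈F : ∀ {x x'} → x ∈ X → x' ∈ S → x' ∈ cl ⁅ x ⁆ → x' ∈ F
    rep∈F x∈X x'∈S x'∈clx = x∈p∩q⁺ (cl⁅⁆⊆cl (⊆-cl x∈X) x'∈clx , x'∈S)
    ∈X∩clF : ∀ {x x'} → x ∈ X → x ∈ cl ⁅ x' ⁆ → x' ∈ F → x ∈ X ∩ cl F
    ∈X∩clF x∈X x∈clx' x'∈F = x∈p∩q⁺ (x∈X , cl⁅⁆⊆cl (⊆-cl x'∈F) x∈clx')
    reps-distinct : ∀ {x y x' y'} → y ∉ cl ⁅ x ⁆ → x' ∈ cl ⁅ x ⁆ → y ∈ cl ⁅ y' ⁆ → x' ≢ y'
    reps-distinct y∉clx x'∈clx y∈cly' refl = y∉clx (cl⁅⁆⊆cl x'∈clx y∈cly')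
    e'∈F = rep∈F e∈X e'∈S e'∈cle
    g'∈F = rep∈F g∈X g'∈S g'∈clg
    h'∈F = rep∈F h∈X h'∈S h'∈clh
    F∈Ls : F ∈ₗ Ls
    F∈Ls = Equivalence.from (Ls-longLines F) (cl∩S-longLine ρX≤2
      (reps-distinct g∉cle e'∈cle g∈clg') (reps-distinct h∉cle e'∈cle h∈clh')
      (reps-distinct h∉clg g'∈clg h∈clh') e'∈F g'∈F h'∈F)

  cover-covers : ∀ X → NonBasis M X → Covered X
  cover-covers X nonBasis with ∣p∣≡3⇒distinct (trans (proj₁ nonBasis) rank≡3)
  ... | e , g , h , e∈X , g∈X , h∈X , e≢g , e≢h , g≢h with e ∈? cl ⊥ | g ∈? cl ⊥ | h ∈? cl ⊥
  ... | yes e∈cl⊥ | _ | _ = cover-loop e∈X e∈cl⊥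
  ... | no _ | yes g∈cl⊥ | _ = cover-loop g∈X g∈cl⊥
  ... | no _ | no _ | yes h∈cl⊥ = cover-loop h∈X h∈cl⊥
  ... | no e∉cl⊥ | no g∉cl⊥ | no h∉cl⊥ with g ∈? cl ⁅ e ⁆ | h ∈? cl ⁅ e ⁆ | h ∈? cl ⁅ g ⁆
  ... | yes g∈cle | _ | _ = cover-parallel e∈X g∈X e≢g e∉cl⊥ g∉cl⊥ g∈cle
  ... | no _ | yes h∈cle | _ = cover-parallel e∈X h∈X e≢h e∉cl⊥ h∉cl⊥ h∈cle
  ... | no _ | no _ | yes h∈clg = cover-parallel g∈X h∈X g≢h g∉cl⊥ h∉cl⊥ h∈clg
  ... | no g∉cle | no h∉cle | no h∉clg =
    cover-line ρX≤2 e∈X g∈X h∈X e≢g e≢h g≢h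
      (∉cl⊥⇒¬Loop e∉cl⊥) (∉cl⊥⇒¬Loop g∉cl⊥) (∉cl⊥⇒¬Loop h∉cl⊥) g∉cle h∉cle h∉clg
    where
    ρX≤2 : ρ X ≤ 2
    ρX≤2 = ≤-pred (subst (ρ X <_) rank≡3 (nonBasis⇒ρ<rank nonBasis))

lemma4p3 : (n : ℕ) (M : Matroid n) → rank M ≡ 3
    → (S : Subset n) → SimplificationSet M S
    → (Ls : List (Subset n)) → Unique Ls → (∀ F → (F ∈ₗ Ls) ⇔ LongLineIn M S F)
    → Σ (List (Subset n)) λ C → FlatCover M C × (2 * length C ≤ 2 + n + 2 * length Ls)
lemma4p3 n M rank≡3 S simp Ls _ Ls-longLines = cover , (cover-flat , cover-covers) , cover-length
  where open RankThreeCover M rank≡3 simp Ls Ls-longLines
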